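{- Let $\alpha\in(0,1)$ and let $d=d(n)$ be a function with $d(n)=o(n)$. Then for every graph $G$ on $n$ vertices with minimum degree $\delta(G)\ge\alpha n$ there exists a set $U\subset V(G)$ with $|U|=o(n)$ (with the $o(n)$ bound depending only on $\alpha$ and $d$) such that every connected component of $G[V(G)\setminus U]$ is $d$-connected and contains at least $\frac{\alpha}{2}n$ vertices.
   Context: $G[X]$ denotes the subgraph of $G$ induced by the vertex set $X$. A graph is $d$-connected if it cannot be disconnected by deleting few vertices, in the sense of standard vertex connectivity at level $d$.
   Formalization: The parameter α ranges over the rationals in (0,1). -}

module Defs where

open import Data.Bool using (Bool; true; false)
open import Data.Nat using (ℕ; _≥_) renaming (_<_ to _<ℕ_)
open import Data.Integer using (+_)
open import Data.Fin using (Fin)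
open import Data.Fin.Subset using (Subset; _∈_; _∉_; _⊆_; ∣_∣; _─_; ∁)
open import Data.Vec using (tabulate)
open import Data.Product using (Σ; ∃; _×_)
open import Relation.Binary.PropositionalEquality using (_≡_)
open import Relation.Nullary using (¬_)
open import Data.Rational using (ℚ; _/_; _*_; _≤_; _<_; 0ℚ)

⟦_⟧ : ℕ → ℚ
⟦ n ⟧ = + n / 1

record Graph (n : ℕ) : Set where
  field
    adj   : Fin n → Fin n → Bool
    sym   : ∀ u v → adj u v ≡ adj v u
    irrefl : ∀ v → adj v v ≡ false
open Graph public

module _ {n : ℕ} (G : Graph n) where

  Adj : Fin n → Fin n → Set
  Adj u v = adj G u v ≡ true

  N : Fin n → Subset n
  N v = tabulate (adj G v)

  deg : Fin n → ℕ
  deg v = ∣ N v ∣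

  MinDegGe : ℚ → Set
  MinDegGe k = ∀ v → k ≤ ⟦ deg v ⟧

  data Walk (X : Subset n) : Fin n → Fin n → Set where
    here : ∀ {u} → u ∈ X → Walk X u u
    step : ∀ {u w v} → u ∈ X → Adj u w → Walk X w v → Walk X u v

  Connected : Subset n → Set
  Connected X = (∃ λ v → v ∈ X) × (∀ u v → u ∈ X → v ∈ X → Walk X u v)

  DConnected : ℕ → Subset n → Set
  DConnected d X = (d <ℕ ∣ X ∣) × (∀ S → ∣ S ∣ <ℕ d → Connected (X ─ S))

  IsComponent : Subset n → Subset n → Set
  IsComponent W C = C ⊆ W × Connected C ×
    (∀ u v → u ∈ C → v ∈ W → Adj u v → v ∈ C)

LittleO : (ℕ → ℕ) → Set
LittleO f = ∀ ε → 0ℚ < ε → ∃ λ N → ∀ n → n ≥ N → ⟦ f n ⟧ ≤ ε * ⟦ n ⟧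

{-# OPTIONS --safe #-}

-- Repeatedly take a component C of G[∁ U] that is not d-connected, a set S of fewer than d
-- vertices and two vertices of C ─ S that S separates, and add C ∩ S to U. While U is small,
-- every vertex keeps more than αn/2 neighbours outside U, so every component of G[∁ U] has at
-- least αn/2 > d vertices and vertices in different components have disjoint neighbourhoods
-- outside U: there are at most 2/α components. Each step increases their number, so the
-- process stops after at most 2/α steps, with |U| ≤ 2d/α = o(n). Constructively, components
-- are counted by a list of representatives joined pairwise by no walk in G[∁ U]. For the
-- finitely many small n, U is the whole vertex set.

module Submission where

open import Defs
open import Data.Nat using (ℕ; _≤_)
open import Data.Fin.Subset using (Subset; ∣_∣; ∁)
open import Data.Product using (Σ; ∃; _×_)
open import Data.Rational using (ℚ; _*_; _<_; 0ℚ; 1ℚ; ½) renaming (_≤_ to _≤ℚ_)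

open import Data.Bool using (true; if_then_else_)
import Data.Bool.Properties as Bool
open import Data.Fin as Fin using (Fin)
open import Data.Fin.Properties using (any?; all?)
open import Data.Fin.Subset
  using (_∈_; _∉_; _⊆_; _∪_; _∩_; _─_; _-_; ⁅_⁆; ⊥; ⊤; ⋃; Empty; Nonempty; outside; inside)
open import Data.Fin.Subset.Properties
  using ( _∈?_; _⊆?_; nonempty?; anySubset?; ∈⊤; ∉⊥; x∈⁅x⁆; x∈p∪q⁺; x∈p∪q⁻; x∈p∩q⁺; x∈p∩q⁻
        ; x∈p∧x∉q⇒x∈p─q; x∈p∧x≢y⇒x∈p-y; x∉p⇒x∈∁p; x∈∁p⇒x∉p; p─q⊆p; p⊆p∪q; p⊆q⇒∁p⊇∁q
        ; p⊆q⇒∣p∣≤∣q∣; ∣p∩q∣≤∣q∣; x∈p⇒∣p-x∣<∣p∣; ∣p∣≤n; ∣⊤∣≡n; ∣⊥∣≡0; Empty-unique )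
open import Data.Integer using (+_; -[1+_]; +≤+; +<+)
import Data.Integer.Properties as ℤ
open import Data.List using (List; []; _∷_; map; length; filter)
open import Data.List.Properties using (filter-all)
open import Data.List.Relation.Unary.All as All using (All; []; _∷_)
import Data.List.Relation.Unary.All.Properties as All
open import Data.List.Relation.Unary.AllPairs as AllPairs using (AllPairs; []; _∷_)
import Data.List.Relation.Unary.AllPairs.Properties as AllPairs
open import Data.Nat as ℕ using (zero; suc; _+_; z≤n; s≤s; z<s)
import Data.Nat.Coprimality as Coprime
open import Data.Nat.ListAction using (sum)
import Data.Nat.Properties as ℕ
open import Data.Product as Product using (_,_; proj₁; proj₂)
open import Data.Rational
  using (mkℚ; _/_; *≤*; *<*; toℚᵘ; 1/_; Positive; NonNegative; NonZero; positive; nonNegative)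
import Data.Rational.Properties as ℚ
open import Data.Rational.Solver using (module +-*-Solver)
open import Data.Rational.Unnormalised as ℚᵘ using (mkℚᵘ)
import Data.Rational.Unnormalised.Properties as ℚᵘ
open import Data.Sum using (_⊎_; inj₁; inj₂; [_,_]′)
open import Data.Vec using ([]; _∷_; here; there)
open import Data.Vec.Properties using (lookup∘tabulate; []=⇒lookup)
open import Function using (_∘_)
open import Relation.Nullary using (¬_; Dec; yes; no; does; contradiction)
open import Relation.Nullary.Decidable
  using (dec-true; dec-false; map′; decidable-stable; ¬?; _⊎-dec_; _×-dec_; _→-dec_)
open import Relation.Unary using (Decidable)
import Relation.Binary.PropositionalEquality as ≡
open ≡ using (_≡_; refl; cong; cong₂)

open +-*-Solver using (solve; _:=_; _:*_)

Disjoint : ∀ {n} → Subset n → Subset n → Set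
Disjoint p q = Empty (p ∩ q)

∣p∪q∣+∣p∩q∣≡∣p∣+∣q∣ : ∀ {n} (p q : Subset n) → ∣ p ∪ q ∣ + ∣ p ∩ q ∣ ≡ ∣ p ∣ + ∣ q ∣
∣p∪q∣+∣p∩q∣≡∣p∣+∣q∣ []            []            = refl
∣p∪q∣+∣p∩q∣≡∣p∣+∣q∣ (inside  ∷ p) (inside  ∷ q) = cong suc (≡.trans (ℕ.+-suc _ _)
  (≡.trans (cong suc (∣p∪q∣+∣p∩q∣≡∣p∣+∣q∣ p q)) (≡.sym (ℕ.+-suc _ _))))
∣p∪q∣+∣p∩q∣≡∣p∣+∣q∣ (inside  ∷ p) (outside ∷ q) = cong suc (∣p∪q∣+∣p∩q∣≡∣p∣+∣q∣ p q)
∣p∪q∣+∣p∩q∣≡∣p∣+∣q∣ (outside ∷ p) (inside  ∷ q) = ≡.trans (cong suc (∣p∪q∣+∣p∩q∣≡∣p∣+∣q∣ p q)) (≡.sym (ℕ.+-suc _ _))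
∣p∪q∣+∣p∩q∣≡∣p∣+∣q∣ (outside ∷ p) (outside ∷ q) = ∣p∪q∣+∣p∩q∣≡∣p∣+∣q∣ p q

∣p∪q∣≤∣p∣+∣q∣ : ∀ {n} (p q : Subset n) → ∣ p ∪ q ∣ ≤ ∣ p ∣ + ∣ q ∣
∣p∪q∣≤∣p∣+∣q∣ p q = ℕ.≤-trans (ℕ.m≤m+n _ _) (ℕ.≤-reflexive (∣p∪q∣+∣p∩q∣≡∣p∣+∣q∣ p q))

Disjoint⇒∣p∪q∣≡∣p∣+∣q∣ : ∀ {n} {p q : Subset n} → Disjoint p q → ∣ p ∪ q ∣ ≡ ∣ p ∣ + ∣ q ∣
Disjoint⇒∣p∪q∣≡∣p∣+∣q∣ {n} {p} {q} p∩q=∅ = begin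
  ∣ p ∪ q ∣              ≡⟨ ℕ.+-identityʳ _ ⟨
  ∣ p ∪ q ∣ + 0          ≡⟨ cong (λ r → ∣ p ∪ q ∣ + r) (∣⊥∣≡0 n) ⟨
  ∣ p ∪ q ∣ + ∣ ⊥ {n} ∣  ≡⟨ cong (λ r → ∣ p ∪ q ∣ + ∣ r ∣) (Empty-unique p∩q=∅) ⟨
  ∣ p ∪ q ∣ + ∣ p ∩ q ∣  ≡⟨ ∣p∪q∣+∣p∩q∣≡∣p∣+∣q∣ p q ⟩
  ∣ p ∣ + ∣ q ∣          ∎
  where open ≡.≡-Reasoning

Disjoint-⋃ : ∀ {n} {p : Subset n} {qs} → All (Disjoint p) qs → Disjoint p (⋃ qs)
Disjoint-⋃ {qs = []} [] (x , x∈p∩⊥) = ∉⊥ (proj₂ (x∈p∩q⁻ _ ⊥ x∈p∩⊥))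
Disjoint-⋃ {p = p} {q ∷ qs} (p∩q=∅ ∷ rest) (x , x∈p∩⋃) with x∈p∩q⁻ p _ x∈p∩⋃
... | x∈p , x∈⋃ with x∈p∪q⁻ q (⋃ qs) x∈⋃
...   | inj₁ x∈q  = p∩q=∅ (x , x∈p∩q⁺ (x∈p , x∈q))
...   | inj₂ x∈qs = Disjoint-⋃ rest (x , x∈p∩q⁺ (x∈p , x∈qs))

sum∣∣≤∣⋃∣ : ∀ {n} (ps : List (Subset n)) → AllPairs Disjoint ps → sum (map ∣_∣ ps) ≤ ∣ ⋃ ps ∣
sum∣∣≤∣⋃∣ []       []                = z≤n
sum∣∣≤∣⋃∣ (p ∷ ps) (p-disj ∷ ps-disj) = ℕ.≤-trans (ℕ.+-monoʳ-≤ ∣ p ∣ (sum∣∣≤∣⋃∣ ps ps-disj))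
  (ℕ.≤-reflexive (≡.sym (Disjoint⇒∣p∪q∣≡∣p∣+∣q∣ (Disjoint-⋃ p-disj))))

x∈p─q⇒x∉q : ∀ {n} {x : Fin n} (p q : Subset n) → x ∈ p ─ q → x ∉ q
x∈p─q⇒x∉q (_ ∷ p) (inside  ∷ q) () here
x∈p─q⇒x∉q (_ ∷ p) (_ ∷ q) (there x∈p─q) (there x∈q) = x∈p─q⇒x∉q p q x∈p─q x∈q

p⊆p─q∪q : ∀ {n} (p q : Subset n) → p ⊆ (p ─ q) ∪ q
p⊆p─q∪q p q {x} x∈p with x ∈? q
... | yes x∈q = x∈p∪q⁺ (inj₂ x∈q)
... | no  x∉q = x∈p∪q⁺ (inj₁ (x∈p∧x∉q⇒x∈p─q x∈p x∉q))

∣p∣≤∣p─q∣+∣q∣ : ∀ {n} (p q : Subset n) → ∣ p ∣ ≤ ∣ p ─ q ∣ + ∣ q ∣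
∣p∣≤∣p─q∣+∣q∣ p q = ℕ.≤-trans (p⊆q⇒∣p∣≤∣q∣ (p⊆p─q∪q p q)) (∣p∪q∣≤∣p∣+∣q∣ (p ─ q) q)

∣p∣>0⇒Nonempty : ∀ {n} (p : Subset n) → 0 ℕ.< ∣ p ∣ → Nonempty p
∣p∣>0⇒Nonempty {n} p 0<∣p∣ with nonempty? p
... | yes p≢∅ = p≢∅
... | no  p≡∅ = contradiction (≡.trans (cong ∣_∣ (Empty-unique p≡∅)) (∣⊥∣≡0 n)) (ℕ.>⇒≢ 0<∣p∣)

module _ {A : Set} {P : A → Set} (P? : Decidable P) where

  length≤1+length-filter-¬ : ∀ {xs} → AllPairs (λ x y → ¬ (P x × P y)) xs →
    length xs ≤ suc (length (filter (¬? ∘ P?) xs))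
  length≤1+length-filter-¬ []                              = z≤n
  length≤1+length-filter-¬ {x ∷ xs} (x-exclusive ∷ rest) with P? x
  ... | yes Px = s≤s (ℕ.≤-reflexive (cong length (≡.sym (filter-all (¬? ∘ P?) ¬P-xs))))
    where
    ¬P-xs : All (¬_ ∘ P) xs
    ¬P-xs = All.map (λ ¬[Px×Py] Py → ¬[Px×Py] (Px , Py)) x-exclusive
  ... | no  _  = s≤s (length≤1+length-filter-¬ rest)

1+c*m≤n⇒c*m<n : ∀ c m {n} → suc c ℕ.* m ≤ n → 0 ℕ.< n → c ℕ.* m ℕ.< n
1+c*m≤n⇒c*m<n c zero    _     0<n rewrite ℕ.*-zeroʳ c = 0<n
1+c*m≤n⇒c*m<n c (suc m) 1+c*m≤n _ = ℕ.<-≤-trans (ℕ.m<n+m (c ℕ.* suc m) z<s) 1+c*m≤n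

2x≤K[m+u]∧Ku≤x⇒x≤Km : ∀ K x m u → 2 ℕ.* x ≤ K ℕ.* (m + u) → K ℕ.* u ≤ x → x ≤ K ℕ.* m
2x≤K[m+u]∧Ku≤x⇒x≤Km K x m u 2x≤K[m+u] Ku≤x = ℕ.+-cancelʳ-≤ x x (K ℕ.* m) (begin
  x + x              ≡⟨ cong (λ y → x + y) (ℕ.+-identityʳ x) ⟨
  2 ℕ.* x            ≤⟨ 2x≤K[m+u] ⟩
  K ℕ.* (m + u)      ≡⟨ ℕ.*-distribˡ-+ K m u ⟩
  K ℕ.* m + K ℕ.* u  ≤⟨ ℕ.+-monoʳ-≤ (K ℕ.* m) Ku≤x ⟩
  K ℕ.* m + x        ∎)
  where open ℕ.≤-Reasoning

⟦⟧≡mkℚ : ∀ m → ⟦ m ⟧ ≡ mkℚ (+ m) 0 (Coprime.sym (Coprime.1-coprimeTo m))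
⟦⟧≡mkℚ m = ℚ.normalize-coprime _

⟦⟧-mono-≤ : ∀ {m k} → m ≤ k → ⟦ m ⟧ ≤ℚ ⟦ k ⟧
⟦⟧-mono-≤ {m} {k} m≤k rewrite ⟦⟧≡mkℚ m | ⟦⟧≡mkℚ k = *≤* (ℤ.*-monoʳ-≤-nonNeg (+ 1) (+≤+ m≤k))

⟦⟧-cancel-≤ : ∀ {m k} → ⟦ m ⟧ ≤ℚ ⟦ k ⟧ → m ≤ k
⟦⟧-cancel-≤ {m} {k} m≤k rewrite ⟦⟧≡mkℚ m | ⟦⟧≡mkℚ k with *≤* h ← m≤k =
  ℤ.drop‿+≤+ (ℤ.*-cancelʳ-≤-pos (+ m) (+ k) (+ 1) h)

⟦⟧-homo-* : ∀ m k → ⟦ m ℕ.* k ⟧ ≡ ⟦ m ⟧ * ⟦ k ⟧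
⟦⟧-homo-* m k rewrite ⟦⟧≡mkℚ m | ⟦⟧≡mkℚ k = cong (λ i → i / 1) (ℤ.pos-* m k)

positive⇒fraction : ∀ α → 0ℚ < α → ∃ λ a → ∃ λ b → α * ⟦ suc b ⟧ ≡ ⟦ suc a ⟧
positive⇒fraction (mkℚ (+ zero) _ _) (*<* (+<+ ()))
positive⇒fraction (mkℚ -[1+ _ ] _ _) (*<* ())
positive⇒fraction α@(mkℚ (+ suc a) b _) _ = a , b , ℚ.toℚᵘ-injective (begin
  toℚᵘ (α * ⟦ suc b ⟧)                     ≈⟨ ℚ.toℚᵘ-homo-* α ⟦ suc b ⟧ ⟩
  toℚᵘ α ℚᵘ.* toℚᵘ ⟦ suc b ⟧                ≡⟨ cong (λ q → toℚᵘ α ℚᵘ.* toℚᵘ q) (⟦⟧≡mkℚ (suc b)) ⟩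
  mkℚᵘ (+ suc a) b ℚᵘ.* mkℚᵘ (+ suc b) 0  ≈⟨ ℚᵘ.*≡* (cong (λ k → + suc k) cross-products) ⟩
  mkℚᵘ (+ suc a) 0                         ≡⟨ cong toℚᵘ (⟦⟧≡mkℚ (suc a)) ⟨
  toℚᵘ ⟦ suc a ⟧                           ∎)
  where
  open ℚᵘ.≃-Reasoning
  cross-products : (b + a ℕ.* suc b) ℕ.* 1 ≡ b ℕ.* 1 + a ℕ.* suc (b ℕ.* 1)
  cross-products = ≡.trans (ℕ.*-identityʳ _) (cong (λ c → c + a ℕ.* suc c) (≡.sym (ℕ.*-identityʳ b)))

⟦⟧-positive : ∀ m → .{{ℕ.NonZero m}} → Positive ⟦ m ⟧
⟦⟧-positive m = ℚ.normalize-pos m 1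

⟦⟧-nonNegative : ∀ m → NonNegative ⟦ m ⟧
⟦⟧-nonNegative m = nonNegative (⟦⟧-mono-≤ {0} {m} z≤n)

module _ {α : ℚ} {a b : ℕ} (α*b≡a : α * ⟦ b ⟧ ≡ ⟦ a ⟧) where

  α*n*b≡⟦a*n⟧ : ∀ n → α * ⟦ n ⟧ * ⟦ b ⟧ ≡ ⟦ a ℕ.* n ⟧
  α*n*b≡⟦a*n⟧ n = begin
    α * ⟦ n ⟧ * ⟦ b ⟧  ≡⟨ solve 3 (λ α n b → α :* n :* b := α :* b :* n) refl α ⟦ n ⟧ ⟦ b ⟧ ⟩
    α * ⟦ b ⟧ * ⟦ n ⟧  ≡⟨ cong (_* ⟦ n ⟧) α*b≡a ⟩
    ⟦ a ⟧ * ⟦ n ⟧      ≡⟨ ⟦⟧-homo-* a n ⟨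
    ⟦ a ℕ.* n ⟧        ∎
    where open ≡.≡-Reasoning

  α*n≤m⇒a*n≤b*m : ∀ {n m} → α * ⟦ n ⟧ ≤ℚ ⟦ m ⟧ → a ℕ.* n ≤ b ℕ.* m
  α*n≤m⇒a*n≤b*m {n} {m} αn≤m = ⟦⟧-cancel-≤ (begin
    ⟦ a ℕ.* n ⟧        ≡⟨ α*n*b≡⟦a*n⟧ n ⟨
    α * ⟦ n ⟧ * ⟦ b ⟧  ≤⟨ ℚ.*-monoʳ-≤-nonNeg ⟦ b ⟧ {{⟦⟧-nonNegative b}} αn≤m ⟩
    ⟦ m ⟧ * ⟦ b ⟧      ≡⟨ ℚ.*-comm ⟦ m ⟧ ⟦ b ⟧ ⟩
    ⟦ b ⟧ * ⟦ m ⟧      ≡⟨ ⟦⟧-homo-* b m ⟨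
    ⟦ b ℕ.* m ⟧        ∎)
    where open ℚ.≤-Reasoning

  a*n≤2b*m⇒½*α*n≤m : ∀ {n m} → .{{ℕ.NonZero b}} → a ℕ.* n ≤ 2 ℕ.* b ℕ.* m → ½ * α * ⟦ n ⟧ ≤ℚ ⟦ m ⟧
  a*n≤2b*m⇒½*α*n≤m {n} {m} an≤2bm = ℚ.*-cancelʳ-≤-pos ⟦ 2 ℕ.* b ⟧ {{⟦⟧-positive (2 ℕ.* b) {{ℕ.m*n≢0 2 b}}}} (begin
    ½ * α * ⟦ n ⟧ * ⟦ 2 ℕ.* b ⟧          ≡⟨ cong (½ * α * ⟦ n ⟧ *_) (⟦⟧-homo-* 2 b) ⟩
    ½ * α * ⟦ n ⟧ * (⟦ 2 ⟧ * ⟦ b ⟧)      ≡⟨ regroup ½ α ⟦ n ⟧ ⟦ 2 ⟧ ⟦ b ⟧ ⟩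
    (½ * ⟦ 2 ⟧) * (α * ⟦ n ⟧ * ⟦ b ⟧)    ≡⟨ cong₂ _*_ ½*2≡1 (α*n*b≡⟦a*n⟧ n) ⟩
    1ℚ * ⟦ a ℕ.* n ⟧                     ≡⟨ ℚ.*-identityˡ _ ⟩
    ⟦ a ℕ.* n ⟧                          ≤⟨ ⟦⟧-mono-≤ an≤2bm ⟩
    ⟦ 2 ℕ.* b ℕ.* m ⟧                    ≡⟨ cong ⟦_⟧ (ℕ.*-comm (2 ℕ.* b) m) ⟩
    ⟦ m ℕ.* (2 ℕ.* b) ⟧                  ≡⟨ ⟦⟧-homo-* m (2 ℕ.* b) ⟩
    ⟦ m ⟧ * ⟦ 2 ℕ.* b ⟧                  ∎)
    where
    open ℚ.≤-Reasoning
    regroup : ∀ h α n t b → h * α * n * (t * b) ≡ (h * t) * (α * n * b)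
    regroup = solve 5 (λ h α n t b → h :* α :* n :* (t :* b) := (h :* t) :* (α :* n :* b)) refl
    ½*2≡1 : ½ * ⟦ 2 ⟧ ≡ 1ℚ
    ½*2≡1 = refl

LittleO-*ˡ : ∀ k {g} → LittleO g → LittleO (λ n → k ℕ.* g n)
LittleO-*ˡ k {g} g=o ε 0<ε = n₀ , kg≤εn
  where
  s : ℚ
  s = ⟦ suc k ⟧
  instance
    s-positive : Positive s
    s-positive = ⟦⟧-positive (suc k)
    s-nonZero : NonZero s
    s-nonZero = ℚ.pos⇒nonZero s
  ε/s-positive : 0ℚ < ε * 1/ s
  ε/s-positive = ℚ.positive⁻¹ _ {{ℚ.pos*pos⇒pos ε {{positive 0<ε}} (1/ s) {{ℚ.1/pos⇒pos s}}}}
  n₀ : ℕ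
  n₀ = proj₁ (g=o (ε * 1/ s) ε/s-positive)
  kg≤εn : ∀ n → n ℕ.≥ n₀ → ⟦ k ℕ.* g n ⟧ ≤ℚ ε * ⟦ n ⟧
  kg≤εn n n₀≤n = begin
    ⟦ k ℕ.* g n ⟧             ≤⟨ ⟦⟧-mono-≤ (ℕ.*-monoˡ-≤ (g n) (ℕ.n≤1+n k)) ⟩
    ⟦ suc k ℕ.* g n ⟧         ≡⟨ ⟦⟧-homo-* (suc k) (g n) ⟩
    s * ⟦ g n ⟧               ≤⟨ ℚ.*-monoˡ-≤-nonNeg s {{ℚ.pos⇒nonNeg s}} (proj₂ (g=o (ε * 1/ s) ε/s-positive) n n₀≤n) ⟩
    s * (ε * 1/ s * ⟦ n ⟧)    ≡⟨ regroup s ε (1/ s) ⟦ n ⟧ ⟩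
    (s * 1/ s) * (ε * ⟦ n ⟧)  ≡⟨ cong (_* (ε * ⟦ n ⟧)) (ℚ.*-inverseʳ s) ⟩
    1ℚ * (ε * ⟦ n ⟧)          ≡⟨ ℚ.*-identityˡ _ ⟩
    ε * ⟦ n ⟧                 ∎
    where
    open ℚ.≤-Reasoning
    regroup : ∀ s ε t n → s * (ε * t * n) ≡ (s * t) * (ε * n)
    regroup = solve 4 (λ s ε t n → s :* (ε :* t :* n) := (s :* t) :* (ε :* n)) refl

LittleO-≤ : ∀ {f g} → LittleO g → (∃ λ n₀ → ∀ n → n ℕ.≥ n₀ → f n ≤ g n) → LittleO f
LittleO-≤ g=o (n₀ , f≤g) ε 0<ε with g=o ε 0<ε
... | n₁ , g≤εn = n₀ ℕ.⊔ n₁ , λ n n≥n₀⊔n₁ →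
  ℚ.≤-trans (⟦⟧-mono-≤ (f≤g n (ℕ.m⊔n≤o⇒m≤o n₀ n₁ n≥n₀⊔n₁))) (g≤εn n (ℕ.m⊔n≤o⇒n≤o n₀ n₁ n≥n₀⊔n₁))

LittleO⇒eventually-< : ∀ {g} → LittleO g → ∀ c → ∃ λ n₀ → ∀ n → n ℕ.≥ n₀ → c ℕ.* g n ℕ.< n
LittleO⇒eventually-< {g} g=o c = suc n₀ , c*g<n
  where
  [1+c]g≤n-eventually : ∃ λ n₀ → ∀ n → n ℕ.≥ n₀ → ⟦ suc c ℕ.* g n ⟧ ≤ℚ ⟦ 1 ⟧ * ⟦ n ⟧
  [1+c]g≤n-eventually = LittleO-*ˡ (suc c) {g} g=o ⟦ 1 ⟧ (ℚ.positive⁻¹ ⟦ 1 ⟧ {{⟦⟧-positive 1}})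
  n₀ : ℕ
  n₀ = proj₁ [1+c]g≤n-eventually
  c*g<n : ∀ n → n ℕ.> n₀ → c ℕ.* g n ℕ.< n
  c*g<n n n>n₀ = 1+c*m≤n⇒c*m<n c (g n) [1+c]g≤n (ℕ.<-≤-trans z<s n>n₀)
    where
    [1+c]g≤n : suc c ℕ.* g n ≤ n
    [1+c]g≤n = ⟦⟧-cancel-≤ (begin
      ⟦ suc c ℕ.* g n ⟧  ≤⟨ proj₂ [1+c]g≤n-eventually n (ℕ.<⇒≤ n>n₀) ⟩
      ⟦ 1 ⟧ * ⟦ n ⟧      ≡⟨ ⟦⟧-homo-* 1 n ⟨
      ⟦ 1 ℕ.* n ⟧        ≡⟨ cong ⟦_⟧ (ℕ.*-identityˡ n) ⟩
      ⟦ n ⟧              ∎)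
      where open ℚ.≤-Reasoning

cutoff : ℕ → (ℕ → ℕ) → ℕ → ℕ
cutoff n₀ g n = if does (n ℕ.<? n₀) then n else g n

cutoff-below : ∀ {n₀ g n} → n ℕ.< n₀ → cutoff n₀ g n ≡ n
cutoff-below {n₀} {n = n} n<n₀ rewrite dec-true (n ℕ.<? n₀) n<n₀ = refl

cutoff-above : ∀ {n₀ g n} → n ℕ.≥ n₀ → cutoff n₀ g n ≡ g n
cutoff-above {n₀} {n = n} n≥n₀ rewrite dec-false (n ℕ.<? n₀) (ℕ.≤⇒≯ n≥n₀) = refl

LittleO-cutoff : ∀ n₀ {g} → LittleO g → LittleO (cutoff n₀ g)
LittleO-cutoff n₀ {g} g=o = LittleO-≤ g=o (n₀ , λ n n≥n₀ → ℕ.≤-reflexive (cutoff-above {n₀} {g} n≥n₀))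

-- Walks and components

module _ {n : ℕ} (G : Graph n) where

  Walk-start : ∀ {X u v} → Walk G X u v → u ∈ X
  Walk-start (here u∈X)     = u∈X
  Walk-start (step u∈X _ _) = u∈X

  Walk-end : ∀ {X u v} → Walk G X u v → v ∈ X
  Walk-end (here v∈X)      = v∈X
  Walk-end (step _ _ walk) = Walk-end walk

  Walk-mono : ∀ {X Y u v} → X ⊆ Y → Walk G X u v → Walk G Y u v
  Walk-mono X⊆Y (here u∈X)            = here (X⊆Y u∈X)
  Walk-mono X⊆Y (step u∈X u~w walk)   = step (X⊆Y u∈X) u~w (Walk-mono X⊆Y walk)

  N⇒Adj : ∀ {u v} → v ∈ N G u → Adj G u v
  N⇒Adj {u} {v} v∈Nu = ≡.trans (≡.sym (lookup∘tabulate (adj G u) v)) ([]=⇒lookup v∈Nu)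

  Adj-sym : ∀ {u v} → Adj G u v → Adj G v u
  Adj-sym {u} {v} u~v = ≡.trans (sym G v u) u~v

  Adj? : ∀ u v → Dec (Adj G u v)
  Adj? u v = adj G u v Bool.≟ true

  Walk-avoiding⊎leaving : ∀ {X a v} u → Walk G X a v →
    Walk G (X - u) a v ⊎ u ≡ v ⊎ ∃ λ w → Adj G u w × Walk G (X - u) w v
  Walk-avoiding⊎leaving u (here {a} a∈X) with a Fin.≟ u
  ... | yes refl = inj₂ (inj₁ refl)
  ... | no  a≢u  = inj₁ (here (x∈p∧x≢y⇒x∈p-y a∈X a≢u))
  Walk-avoiding⊎leaving u (step {a} {w} a∈X a~w walk) with Walk-avoiding⊎leaving u walk
  ... | inj₂ leaving     = inj₂ leaving
  ... | inj₁ avoiding with a Fin.≟ u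
  ...   | yes refl = inj₂ (inj₂ (w , a~w , avoiding))
  ...   | no  a≢u  = inj₁ (step (x∈p∧x≢y⇒x∈p-y a∈X a≢u) a~w avoiding)

  Walk-from⇒leaving : ∀ {X u v} → Walk G X u v → u ≡ v ⊎ ∃ λ w → Adj G u w × Walk G (X - u) w v
  Walk-from⇒leaving {X} {u} walk with Walk-avoiding⊎leaving u walk
  ... | inj₁ avoiding = contradiction (x∈⁅x⁆ u) (x∈p─q⇒x∉q X ⁅ u ⁆ (Walk-start avoiding))
  ... | inj₂ leaving  = leaving

  Walk? : ∀ X u v → Dec (Walk G X u v)
  Walk? X = Walk?-fuel n X (∣p∣≤n X)
    where
    Walk?-fuel : ∀ k X → ∣ X ∣ ≤ k → ∀ u v → Dec (Walk G X u v)
    Walk?-fuel k X ∣X∣≤k u v with u ∈? X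
    ... | no  u∉X = no (u∉X ∘ Walk-start)
    ... | yes u∈X with k
    ...   | zero  = contradiction ∣X∣≤k (ℕ.<⇒≱ (ℕ.≤-<-trans z≤n (x∈p⇒∣p-x∣<∣p∣ u∈X)))
    ...   | suc k = map′ build Walk-from⇒leaving
                      ((u Fin.≟ v) ⊎-dec any? (λ w → Adj? u w ×-dec Walk?-fuel k (X - u) ∣X-u∣≤k w v))
      where
      ∣X-u∣≤k : ∣ X - u ∣ ≤ k
      ∣X-u∣≤k = ℕ.≤-pred (ℕ.≤-trans (x∈p⇒∣p-x∣<∣p∣ u∈X) ∣X∣≤k)
      build : u ≡ v ⊎ (∃ λ w → Adj G u w × Walk G (X - u) w v) → Walk G X u v
      build (inj₁ refl)               = here u∈X
      build (inj₂ (w , u~w , walk))   = step u∈X u~w (Walk-mono (p─q⊆p X ⁅ u ⁆) walk)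

  Connected? : ∀ X → Dec (Connected G X)
  Connected? X = nonempty? X ×-dec all? λ u → all? λ v → u ∈? X →-dec v ∈? X →-dec Walk? X u v

  IsComponent? : ∀ W C → Dec (IsComponent G W C)
  IsComponent? W C = C ⊆? W ×-dec Connected? C ×-dec
    all? λ u → all? λ v → u ∈? C →-dec v ∈? W →-dec Adj? u v →-dec v ∈? C

  ¬Connected⇒separated-pair : ∀ {X} → Nonempty X → ¬ Connected G X →
    ∃ λ u → ∃ λ v → u ∈ X × v ∈ X × ¬ Walk G X u v
  ¬Connected⇒separated-pair {X} X≢∅ ¬connected
    with any? (λ u → any? (λ v → u ∈? X ×-dec v ∈? X ×-dec ¬? (Walk? X u v)))
  ... | yes (u , v , separated) = u , v , separated
  ... | no  ¬separated = contradiction (X≢∅ , walk) ¬connected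
    where
    walk : ∀ u v → u ∈ X → v ∈ X → Walk G X u v
    walk u v u∈X v∈X = decidable-stable (Walk? X u v) λ ¬walk → ¬separated (u , v , u∈X , v∈X , ¬walk)

  N─U⊆component : ∀ {U C v} → IsComponent G (∁ U) C → v ∈ C → N G v ─ U ⊆ C
  N─U⊆component {U} (_ , _ , closed) v∈C {y} y∈Nv─U =
    closed _ y v∈C (x∉p⇒x∈∁p (x∈p─q⇒x∉q (N G _) U y∈Nv─U)) (N⇒Adj (p─q⊆p (N G _) U y∈Nv─U))

  ¬IsComponent-∁⊤ : ∀ {C} → ¬ IsComponent G (∁ ⊤) C
  ¬IsComponent-∁⊤ (C⊆∅ , ((v , v∈C) , _) , _) = x∈∁p⇒x∉p (C⊆∅ v∈C) ∈⊤

  Walk-confined : ∀ {W C Y x y} → IsComponent G W C → Y ⊆ W → x ∈ C → Walk G Y x y → Walk G (C ∩ Y) x y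
  Walk-confined _ _ x∈C (here x∈Y) = here (x∈p∩q⁺ (x∈C , x∈Y))
  Walk-confined C-comp@(_ , _ , closed) Y⊆W x∈C (step x∈Y x~w walk) =
    step (x∈p∩q⁺ (x∈C , x∈Y)) x~w (Walk-confined C-comp Y⊆W (closed _ _ x∈C (Y⊆W (Walk-start walk)) x~w) walk)

  Separated : Subset n → Fin n → Fin n → Set
  Separated W u v = ¬ Walk G W u v

  Separated⇒Disjoint-N─U : ∀ {U r r'} → r ∈ ∁ U → r' ∈ ∁ U → Separated (∁ U) r r' →
    Disjoint (N G r ─ U) (N G r' ─ U)
  Separated⇒Disjoint-N─U {U} {r} {r'} r∈∁U r'∈∁U separated (y , y∈both) with x∈p∩q⁻ _ _ y∈both
  ... | y∈Nr─U , y∈Nr'─U = separated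
    (step r∈∁U (N⇒Adj (p─q⊆p _ U y∈Nr─U))
      (step (x∉p⇒x∈∁p (x∈p─q⇒x∉q _ U y∈Nr─U)) (Adj-sym (N⇒Adj (p─q⊆p _ U y∈Nr'─U))) (here r'∈∁U)))

  record FragileComponent (W : Subset n) (d : ℕ) : Set where
    field
      C         : Subset n
      component : IsComponent G W C
      S         : Subset n
      ∣S∣<d     : ∣ S ∣ ℕ.< d
      u v       : Fin n
      u∈C─S     : u ∈ C ─ S
      v∈C─S     : v ∈ C ─ S
      separated : Separated (C ─ S) u v

  DConnected⊎FragileComponent : ∀ W d → (∀ {C} → IsComponent G W C → d ℕ.< ∣ C ∣) →
    (∀ C → IsComponent G W C → DConnected G d C) ⊎ FragileComponent W d
  DConnected⊎FragileComponent W d large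
    with anySubset? (λ C → IsComponent? W C ×-dec anySubset? (λ S → ∣ S ∣ ℕ.<? d ×-dec ¬? (Connected? (C ─ S))))
  ... | yes (C , C-comp , S , ∣S∣<d , ¬connected) = inj₂ fragile
    where
    ∣S∣<∣C─S∣+∣S∣ : 0 + ∣ S ∣ ℕ.< ∣ C ─ S ∣ + ∣ S ∣
    ∣S∣<∣C─S∣+∣S∣ = ℕ.<-≤-trans (ℕ.<-trans ∣S∣<d (large C-comp)) (∣p∣≤∣p─q∣+∣q∣ C S)
    fragile : FragileComponent W d
    fragile with ¬Connected⇒separated-pair (∣p∣>0⇒Nonempty (C ─ S) (ℕ.+-cancelʳ-< _ 0 _ ∣S∣<∣C─S∣+∣S∣)) ¬connected
    ... | u , v , u∈C─S , v∈C─S , separated = record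
      { C = C ; component = C-comp ; S = S ; ∣S∣<d = ∣S∣<d
      ; u = u ; v = v ; u∈C─S = u∈C─S ; v∈C─S = v∈C─S ; separated = separated }
  ... | no ¬fragile = inj₁ λ C C-comp → large C-comp , λ S ∣S∣<d →
    decidable-stable (Connected? (C ─ S)) λ ¬connected → ¬fragile (C , C-comp , S , ∣S∣<d , ¬connected)

-- Peeling off small separators

-- The minimum degree is at least 2x/K and x ≥ n. The theorem takes α = (a+1)/(b+1),
-- K = 2(b+1) and x = (a+1)n.
module Peeling {n : ℕ} (G : Graph n) (K x d : ℕ)
  (2x≤K*deg : ∀ v → 2 ℕ.* x ≤ K ℕ.* deg G v) (n≤x : n ≤ x) (K[1+K]d<x : K ℕ.* suc K ℕ.* d ℕ.< x) where

  ∣U∣≤[1+K]d⇒K∣U∣≤x : ∀ (U : Subset n) → ∣ U ∣ ≤ suc K ℕ.* d → K ℕ.* ∣ U ∣ ≤ x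
  ∣U∣≤[1+K]d⇒K∣U∣≤x U ∣U∣≤[1+K]d = begin
    K ℕ.* ∣ U ∣          ≤⟨ ℕ.*-monoʳ-≤ K ∣U∣≤[1+K]d ⟩
    K ℕ.* (suc K ℕ.* d)  ≡⟨ ℕ.*-assoc K (suc K) d ⟨
    K ℕ.* suc K ℕ.* d    <⟨ K[1+K]d<x ⟩
    x                    ∎
    where open ℕ.≤-Reasoning

  x≤K∣N─U∣ : ∀ U → K ℕ.* ∣ U ∣ ≤ x → ∀ v → x ≤ K ℕ.* ∣ N G v ─ U ∣
  x≤K∣N─U∣ U K∣U∣≤x v = 2x≤K[m+u]∧Ku≤x⇒x≤Km K x _ ∣ U ∣
    (ℕ.≤-trans (2x≤K*deg v) (ℕ.*-monoʳ-≤ K (∣p∣≤∣p─q∣+∣q∣ (N G v) U))) K∣U∣≤x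

  x≤K∣C∣ : ∀ U {C} → K ℕ.* ∣ U ∣ ≤ x → IsComponent G (∁ U) C → x ≤ K ℕ.* ∣ C ∣
  x≤K∣C∣ U K∣U∣≤x C-comp@(_ , ((v , v∈C) , _) , _) =
    ℕ.≤-trans (x≤K∣N─U∣ U K∣U∣≤x v) (ℕ.*-monoʳ-≤ K (p⊆q⇒∣p∣≤∣q∣ (N─U⊆component G C-comp v∈C)))

  d<∣C∣ : ∀ U {C} → K ℕ.* ∣ U ∣ ≤ x → IsComponent G (∁ U) C → d ℕ.< ∣ C ∣
  d<∣C∣ U {C} K∣U∣≤x C-comp = ℕ.*-cancelˡ-< K d ∣ C ∣ (begin-strict
    K ℕ.* d              ≤⟨ ℕ.*-monoˡ-≤ d (ℕ.m≤m*n K (suc K)) ⟩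
    K ℕ.* suc K ℕ.* d    <⟨ K[1+K]d<x ⟩
    x                    ≤⟨ x≤K∣C∣ U K∣U∣≤x C-comp ⟩
    K ℕ.* ∣ C ∣          ∎)
    where open ℕ.≤-Reasoning

  ∣separated∣≤K : ∀ U → K ℕ.* ∣ U ∣ ≤ x → ∀ {R} → All (_∈ ∁ U) R → AllPairs (Separated G (∁ U)) R → length R ≤ K
  ∣separated∣≤K U K∣U∣≤x {R} R⊆∁U R-separated = ℕ.*-cancelʳ-≤ (length R) K x {{ℕ.>-nonZero 0<x}} (begin
    length R ℕ.* x                          ≤⟨ ∣R∣x≤K∑ R ⟩
    K ℕ.* sum (map ∣_∣ (neighbourhoods R))  ≤⟨ ℕ.*-monoʳ-≤ K (sum∣∣≤∣⋃∣ _ (disjoint R⊆∁U R-separated)) ⟩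
    K ℕ.* ∣ ⋃ (neighbourhoods R) ∣          ≤⟨ ℕ.*-monoʳ-≤ K (ℕ.≤-trans (∣p∣≤n (⋃ (neighbourhoods R))) n≤x) ⟩
    K ℕ.* x                                 ∎)
    where
    open ℕ.≤-Reasoning
    0<x : 0 ℕ.< x
    0<x = ℕ.≤-<-trans z≤n K[1+K]d<x
    neighbourhoods : List (Fin n) → List (Subset n)
    neighbourhoods = map (λ r → N G r ─ U)
    ∣R∣x≤K∑ : ∀ R → length R ℕ.* x ≤ K ℕ.* sum (map ∣_∣ (neighbourhoods R))
    ∣R∣x≤K∑ []      = z≤n
    ∣R∣x≤K∑ (r ∷ R) = ℕ.≤-trans (ℕ.+-mono-≤ (x≤K∣N─U∣ U K∣U∣≤x r) (∣R∣x≤K∑ R))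
      (ℕ.≤-reflexive (≡.sym (ℕ.*-distribˡ-+ K _ _)))
    disjoint : ∀ {R} → All (_∈ ∁ U) R → AllPairs (Separated G (∁ U)) R → AllPairs Disjoint (neighbourhoods R)
    disjoint []                []                     = []
    disjoint (r∈∁U ∷ R⊆∁U) (r-separated ∷ R-separated) =
      All.map⁺ (All.zipWith (λ (r'∈∁U , sep) → Separated⇒Disjoint-N─U G r∈∁U r'∈∁U sep) (R⊆∁U , r-separated))
      ∷ disjoint R⊆∁U R-separated

  record Stage : Set where
    field
      U              : Subset n
      reps           : List (Fin n)
      reps⊆∁U        : All (_∈ ∁ U) reps
      reps-separated : AllPairs (Separated G (∁ U)) reps
      ∣U∣≤∣reps∣d    : ∣ U ∣ ≤ length reps ℕ.* d
      ∣reps∣≤K       : length reps ≤ K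

    ∣U∣≤Kd : ∣ U ∣ ≤ K ℕ.* d
    ∣U∣≤Kd = ℕ.≤-trans ∣U∣≤∣reps∣d (ℕ.*-monoˡ-≤ d ∣reps∣≤K)

    K∣U∣≤x : K ℕ.* ∣ U ∣ ≤ x
    K∣U∣≤x = ∣U∣≤[1+K]d⇒K∣U∣≤x U (ℕ.≤-trans ∣U∣≤Kd (ℕ.*-monoˡ-≤ d (ℕ.n≤1+n K)))

  module Refine (s : Stage) (F : FragileComponent G (∁ (Stage.U s)) d) where
    open Stage s
    open FragileComponent F

    U' : Subset n
    U' = U ∪ (C ∩ S)

    reps₀ : List (Fin n)
    reps₀ = filter (λ r → ¬? (r ∈? C)) reps

    -- u and v replace the at most one representative lying in C.
    reps' : List (Fin n)
    reps' = u ∷ v ∷ reps₀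

    C⊆∁U : C ⊆ ∁ U
    C⊆∁U = proj₁ component

    ∁U'⊆∁U : ∁ U' ⊆ ∁ U
    ∁U'⊆∁U = p⊆q⇒∁p⊇∁q (p⊆p∪q (C ∩ S))

    C∩∁U'⊆C─S : C ∩ ∁ U' ⊆ C ─ S
    C∩∁U'⊆C─S y∈C∩∁U' with x∈p∩q⁻ C (∁ U') y∈C∩∁U'
    ... | y∈C , y∈∁U' = x∈p∧x∉q⇒x∈p─q y∈C λ y∈S →
      x∈∁p⇒x∉p y∈∁U' (x∈p∪q⁺ (inj₂ (x∈p∩q⁺ (y∈C , y∈S))))

    ∈∁U' : ∀ {y} → y ∈ ∁ U → y ∉ C ∩ S → y ∈ ∁ U'
    ∈∁U' y∈∁U y∉C∩S = x∉p⇒x∈∁p λ y∈U' → [ x∈∁p⇒x∉p y∈∁U , y∉C∩S ]′ (x∈p∪q⁻ U (C ∩ S) y∈U')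

    confined : ∀ {y z} → y ∈ C → Walk G (∁ U') y z → Walk G (C ─ S) y z
    confined y∈C walk = Walk-mono G C∩∁U'⊆C─S (Walk-confined G component ∁U'⊆∁U y∈C walk)

    C─S⊆∁U' : C ─ S ⊆ ∁ U'
    C─S⊆∁U' y∈C─S = ∈∁U' (C⊆∁U (p─q⊆p C S y∈C─S)) λ y∈C∩S → x∈p─q⇒x∉q C S y∈C─S (proj₂ (x∈p∩q⁻ C S y∈C∩S))

    reps₀∉C : All (_∉ C) reps₀
    reps₀∉C = All.all-filter (λ r → ¬? (r ∈? C)) reps

    reps₀⊆∁U' : All (_∈ ∁ U') reps₀
    reps₀⊆∁U' = All.zipWith (λ (r∈∁U , r∉C) → ∈∁U' r∈∁U λ r∈C∩S → r∉C (proj₁ (x∈p∩q⁻ C S r∈C∩S)))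
      (All.filter⁺ (λ r → ¬? (r ∈? C)) reps⊆∁U , reps₀∉C)

    separated-from-reps₀ : ∀ {y} → y ∈ C → All (Separated G (∁ U') y) reps₀
    separated-from-reps₀ y∈C = All.map (λ r∉C walk → r∉C (p─q⊆p C S (Walk-end G (confined y∈C walk)))) reps₀∉C

    reps'⊆∁U' : All (_∈ ∁ U') reps'
    reps'⊆∁U' = C─S⊆∁U' u∈C─S ∷ C─S⊆∁U' v∈C─S ∷ reps₀⊆∁U'

    reps'-separated : AllPairs (Separated G (∁ U')) reps'
    reps'-separated =
      (separated ∘ confined (p─q⊆p C S u∈C─S) ∷ separated-from-reps₀ (p─q⊆p C S u∈C─S))
      ∷ separated-from-reps₀ (p─q⊆p C S v∈C─S)
      ∷ AllPairs.map (λ sep → sep ∘ Walk-mono G ∁U'⊆∁U) (AllPairs.filter⁺ (λ r → ¬? (r ∈? C)) reps-separated)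

    ∣reps∣≤1+∣reps₀∣ : length reps ≤ suc (length reps₀)
    ∣reps∣≤1+∣reps₀∣ = length≤1+length-filter-¬ (_∈? C)
      (AllPairs.map (λ sep (r∈C , r'∈C) → sep (Walk-mono G C⊆∁U (proj₂ (proj₁ (proj₂ component)) _ _ r∈C r'∈C)))
        reps-separated)

    ∣U'∣≤[1+∣reps∣]d : ∣ U' ∣ ≤ suc (length reps) ℕ.* d
    ∣U'∣≤[1+∣reps∣]d = begin
      ∣ U' ∣                     ≤⟨ ∣p∪q∣≤∣p∣+∣q∣ U (C ∩ S) ⟩
      ∣ U ∣ + ∣ C ∩ S ∣          ≤⟨ ℕ.+-mono-≤ ∣U∣≤∣reps∣d (ℕ.≤-trans (∣p∩q∣≤∣q∣ C S) (ℕ.<⇒≤ ∣S∣<d)) ⟩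
      length reps ℕ.* d + d      ≡⟨ ℕ.+-comm _ d ⟩
      suc (length reps) ℕ.* d    ∎
      where open ℕ.≤-Reasoning

    K∣U'∣≤x : K ℕ.* ∣ U' ∣ ≤ x
    K∣U'∣≤x = ∣U∣≤[1+K]d⇒K∣U∣≤x U' (ℕ.≤-trans ∣U'∣≤[1+∣reps∣]d (ℕ.*-monoˡ-≤ d (s≤s ∣reps∣≤K)))

    refined : Stage
    refined = record
      { U              = U'
      ; reps           = reps'
      ; reps⊆∁U        = reps'⊆∁U'
      ; reps-separated = reps'-separated
      ; ∣U∣≤∣reps∣d    = ℕ.≤-trans ∣U'∣≤[1+∣reps∣]d (ℕ.*-monoˡ-≤ d (s≤s ∣reps∣≤1+∣reps₀∣))
      ; ∣reps∣≤K       = ∣separated∣≤K U' K∣U'∣≤x reps'⊆∁U' reps'-separated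
      }

    refined-grows : length reps ℕ.< length reps'
    refined-grows = s≤s ∣reps∣≤1+∣reps₀∣

  Decomposition : Set
  Decomposition = ∃ λ (U : Subset n) → ∣ U ∣ ≤ K ℕ.* d ×
    (∀ C → IsComponent G (∁ U) C → DConnected G d C × x ≤ K ℕ.* ∣ C ∣)

  peel-from : ∀ k (s : Stage) → K ≤ length (Stage.reps s) + k → Decomposition
  peel-from k s K≤∣reps∣+k
    with DConnected⊎FragileComponent G (∁ (Stage.U s)) d (d<∣C∣ (Stage.U s) (Stage.K∣U∣≤x s))
  ... | inj₁ dconnected = Stage.U s , Stage.∣U∣≤Kd s ,
    λ C C-comp → dconnected C C-comp , x≤K∣C∣ (Stage.U s) (Stage.K∣U∣≤x s) C-comp
  peel-from zero    s K≤∣reps∣   | inj₂ F = contradiction (Stage.∣reps∣≤K (Refine.refined s F))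
    (ℕ.<⇒≱ (ℕ.≤-<-trans (ℕ.≤-trans K≤∣reps∣ (ℕ.≤-reflexive (ℕ.+-identityʳ _))) (Refine.refined-grows s F)))
  peel-from (suc k) s K≤∣reps∣+1+k | inj₂ F = peel-from k (Refine.refined s F) (begin
    K                                          ≤⟨ K≤∣reps∣+1+k ⟩
    length (Stage.reps s) + suc k              ≡⟨ ℕ.+-suc _ k ⟩
    suc (length (Stage.reps s)) + k            ≤⟨ ℕ.+-monoˡ-≤ k (Refine.refined-grows s F) ⟩
    length (Stage.reps (Refine.refined s F)) + k ∎)
    where open ℕ.≤-Reasoning

  initial : Stage
  initial = record
    { U = ⊥ ; reps = [] ; reps⊆∁U = [] ; reps-separated = []
    ; ∣U∣≤∣reps∣d = ℕ.≤-reflexive (∣⊥∣≡0 n) ; ∣reps∣≤K = z≤n }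

  peel : Decomposition
  peel = peel-from K initial ℕ.≤-refl

module _ {α : ℚ} {a b : ℕ} (α*[1+b]≡1+a : α * ⟦ suc b ⟧ ≡ ⟦ suc a ⟧) where

  dense-decomposition : ∀ {n} (G : Graph n) dn → MinDegGe G (α * ⟦ n ⟧) →
    2 ℕ.* suc b ℕ.* suc (2 ℕ.* suc b) ℕ.* dn ℕ.< n →
    ∃ λ (U : Subset n) → ∣ U ∣ ≤ 2 ℕ.* suc b ℕ.* dn ×
      (∀ C → IsComponent G (∁ U) C → DConnected G dn C × ½ * α * ⟦ n ⟧ ≤ℚ ⟦ ∣ C ∣ ⟧)
  dense-decomposition {n} G dn δ≥αn dn-small = U , ∣U∣≤Kd , λ C C-comp →
    Product.map₂ (a*n≤2b*m⇒½*α*n≤m {α} {suc a} {suc b} α*[1+b]≡1+a {n} {∣ C ∣}) (good C C-comp)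
    where
    2x≤K*deg : ∀ v → 2 ℕ.* (suc a ℕ.* n) ≤ 2 ℕ.* suc b ℕ.* deg G v
    2x≤K*deg v = ℕ.≤-trans
      (ℕ.*-monoʳ-≤ 2 (α*n≤m⇒a*n≤b*m {α} {suc a} {suc b} α*[1+b]≡1+a {n} {deg G v} (δ≥αn v)))
      (ℕ.≤-reflexive (≡.sym (ℕ.*-assoc 2 (suc b) (deg G v))))
    open Peeling G (2 ℕ.* suc b) (suc a ℕ.* n) dn 2x≤K*deg (ℕ.m≤n*m n (suc a))
      (ℕ.<-≤-trans dn-small (ℕ.m≤n*m n (suc a)))
    U : Subset n
    U = proj₁ peel
    ∣U∣≤Kd : ∣ U ∣ ≤ 2 ℕ.* suc b ℕ.* dn
    ∣U∣≤Kd = proj₁ (proj₂ peel)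
    good : ∀ C → IsComponent G (∁ U) C → DConnected G dn C × suc a ℕ.* n ≤ 2 ℕ.* suc b ℕ.* ∣ C ∣
    good = proj₂ (proj₂ peel)

lemma3p2 : (α : ℚ) → 0ℚ < α → α < 1ℚ → (d : ℕ → ℕ) → LittleO d →
    Σ (ℕ → ℕ) λ f → LittleO f ×
      (∀ n (G : Graph n) → MinDegGe G (α * ⟦ n ⟧) →
        ∃ λ (U : Subset n) → ∣ U ∣ ≤ f n ×
          (∀ C → IsComponent G (∁ U) C →
            DConnected G (d n) C × ½ * α * ⟦ n ⟧ ≤ℚ ⟦ ∣ C ∣ ⟧))
lemma3p2 α 0<α _ d d=o = cutoff n₀ Kd , LittleO-cutoff n₀ {Kd} (LittleO-*ˡ K {d} d=o) ,
  λ n G δ≥αn → by-size n G δ≥αn (n ℕ.<? n₀)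
  where
  fraction : ∃ λ a → ∃ λ b → α * ⟦ suc b ⟧ ≡ ⟦ suc a ⟧
  fraction = positive⇒fraction α 0<α
  a b K n₀ : ℕ
  a = proj₁ fraction
  b = proj₁ (proj₂ fraction)
  K = 2 ℕ.* suc b
  d-small : ∃ λ n₀ → ∀ n → n ℕ.≥ n₀ → K ℕ.* suc K ℕ.* d n ℕ.< n
  d-small = LittleO⇒eventually-< {d} d=o (K ℕ.* suc K)
  n₀ = proj₁ d-small
  Kd : ℕ → ℕ
  Kd n = K ℕ.* d n
  by-size : ∀ n (G : Graph n) → MinDegGe G (α * ⟦ n ⟧) → Dec (n ℕ.< n₀) →
    ∃ λ (U : Subset n) → ∣ U ∣ ≤ cutoff n₀ Kd n ×
      (∀ C → IsComponent G (∁ U) C → DConnected G (d n) C × ½ * α * ⟦ n ⟧ ≤ℚ ⟦ ∣ C ∣ ⟧)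
  by-size n G _ (yes n<n₀) = ⊤ , ℕ.≤-reflexive (≡.trans (∣⊤∣≡n n) (≡.sym (cutoff-below {g = Kd} n<n₀))) ,
    λ C C-comp → contradiction C-comp (¬IsComponent-∁⊤ G)
  by-size n G δ≥αn (no n≮n₀) = Product.map₂ (Product.map₁ (λ ∣U∣≤Kd → ℕ.≤-trans ∣U∣≤Kd Kd≤f))
    (dense-decomposition {α} {a} {b} (proj₂ (proj₂ fraction)) G (d n) δ≥αn (proj₂ d-small n n≥n₀))
    where
    n≥n₀ : n ℕ.≥ n₀
    n≥n₀ = ℕ.≮⇒≥ n≮n₀
    Kd≤f : Kd n ≤ cutoff n₀ Kd n
    Kd≤f = ℕ.≤-reflexive (≡.sym (cutoff-above {g = Kd} n≥n₀))
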